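{- Let $G$ be a finite simple graph without isolated vertices with minimum degree $\delta(G)=1$ and maximum degree $\Delta(G)$. Then $C_{tr}(G)\le \Delta(G)+1$.
   Context: A set $S\subseteq V$ is a total restrained dominating set (TRD-set) of $G=(V,E)$ if every vertex of $V\setminus S$ is adjacent to at least one vertex of $S$ and to at least one other vertex of $V\setminus S$, and every vertex of $S$ is adjacent to at least one other vertex of $S$. Two disjoint sets $X,Y\subseteq V$ form a total restrained coalition if neither is a TRD-set but $X\cup Y$ is a TRD-set. A trc-partition of $G$ is a partition $\Phi$ of $V$ such that no member of $\Phi$ is a TRD-set and each member forms a total restrained coalition with some other member of $\Phi$. $C_{tr}(G)$ is the maximum cardinality of a trc-partition of $G$. -}

module Defs where

open import Data.Nat using (ℕ; _≤_; _⊔_)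
open import Data.Bool using (Bool; true; false; T)
open import Data.Fin using (Fin)
open import Data.Fin.Subset using (Subset; _∈_; _∉_; Nonempty)
open import Data.List using (List; map; foldr; length; filter; allFin)
open import Data.List.Membership.Propositional using () renaming (_∈_ to _∈ₗ_)
open import Data.Product using (Σ; ∃; ∃-syntax; _×_; _,_)
open import Relation.Nullary using (¬_)
open import Relation.Binary.PropositionalEquality using (_≡_; _≢_)
open import Data.Vec using (lookup)

record Graph (n : ℕ) : Set where
  field
    adj   : Fin n → Fin n → Bool
    sym   : ∀ u v → adj u v ≡ adj v u
    irrefl : ∀ v → adj v v ≡ false
open Graph public

Adj : ∀ {n} → Graph n → Fin n → Fin n → Set
Adj G u v = T (adj G u v)

degree : ∀ {n} → Graph n → Fin n → ℕ
degree G v = length (filter (λ u → Data.Bool._≟_ (adj G v u) true) (allFin _))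

maxDeg : ∀ {n} → Graph n → ℕ
maxDeg G = foldr _⊔_ 0 (map (degree G) (allFin _))

NoIsolated : ∀ {n} → Graph n → Set
NoIsolated G = ∀ v → ∃[ u ] Adj G v u

MinDegOne : ∀ {n} → Graph n → Set
MinDegOne G = (∀ v → 1 ≤ degree G v) × ∃[ v ] degree G v ≡ 1

IsTRD : ∀ {n} → Graph n → Subset n → Set
IsTRD G S =
  (∀ v → v ∉ S → (∃[ u ] (u ∈ S × Adj G v u)) × (∃[ w ] (w ∉ S × w ≢ v × Adj G v w)))
  × (∀ v → v ∈ S → ∃[ u ] (u ∈ S × u ≢ v × Adj G v u))

Disjoint : ∀ {n} → Subset n → Subset n → Set
Disjoint X Y = ∀ v → v ∈ X → v ∉ Y

TRCoalition : ∀ {n} → Graph n → Subset n → Subset n → Set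
TRCoalition G X Y = Disjoint X Y × ¬ IsTRD G X × ¬ IsTRD G Y × IsTRD G (X Data.Fin.Subset.∪ Y)

IsPartition : ∀ {n} → List (Subset n) → Set
IsPartition {n} Φ =
  (∀ X → X ∈ₗ Φ → Nonempty X)
  × (∀ v → Σ (Fin (length Φ)) λ i → v ∈ Data.List.lookup Φ i
       × (∀ j → v ∈ Data.List.lookup Φ j → j ≡ i))

IsTrcPartition : ∀ {n} → Graph n → List (Subset n) → Set
IsTrcPartition G Φ =
  IsPartition Φ
  × (∀ i → ¬ IsTRD G (Data.List.lookup Φ i))
  × (∀ i → ∃[ j ] (j ≢ i × TRCoalition G (Data.List.lookup Φ i) (Data.List.lookup Φ j)))

-- A leaf v and its unique neighbour u lie in every TRD-set: if v ∉ S, its only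
-- neighbour would have to be both in S and outside S; if v ∈ S, its neighbour in S is u.
-- Hence every union of coalition partners contains v and u.  If v and u lie in different
-- blocks, every block is one of these two.  If both lie in one block A, every other
-- block is a partner of A, so A ∪ B is a TRD-set for every block B ≠ A while A itself
-- is not.  Either some vertex x has no neighbour in A, and then x has a neighbour in
-- each of the other blocks, so |Φ| - 1 ≤ deg x; or some x ∉ A has all its neighbours
-- in A, and then no block besides A and the block of x can exist.
module Submission where

open import Defs hiding (sym)
open import Data.Nat using (ℕ; _≤_; _+_)
open import Data.List using (List; length)
open import Data.Fin.Subset using (Subset)

open import Data.Nat using (suc; s≤s; _⊔_)
open import Data.Nat.Properties using (≤-trans; m≤m⊔n; m≤n⊔m; +-comm; +-monoˡ-≤)
open import Data.Bool using (true; T)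
open import Data.Bool.Properties using (T-≡)
open import Data.Fin using (Fin; punchIn) renaming (zero to fzero; suc to fsuc)
open import Data.Fin.Properties using (injective⇒≤; punchIn-injective; punchInᵢ≢i; any?) renaming (_≟_ to _≟ᶠ_)
open import Data.Fin.Subset using (_∈_; _∉_; _∪_; ∁)
open import Data.Fin.Subset.Properties using (_∈?_; x∈p∪q⁻; p⊆p∪q; ∪-comm; x∈∁p⇒x∉p; x∉p⇒x∈∁p)
import Data.List as List
open import Data.List.Membership.Propositional using () renaming (_∈_ to _∈ₗ_)
open import Data.List.Membership.Propositional.Properties using (∈-allFin; ∈-filter⁺)
open import Data.List.Relation.Unary.Any using (here; there; index)
open import Data.List.Relation.Unary.Any.Properties using (lookup-index)
open import Data.Product using (∃-syntax; _×_; _,_; proj₁; proj₂)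
open import Data.Sum using (_⊎_; inj₁; inj₂)
open import Data.Empty using (⊥-elim)
open import Function using (_∘_)
open import Relation.Nullary using (¬_; yes; no)
open import Relation.Nullary.Decidable using (Dec; T?; ¬?; _×-dec_; decidable-stable)
open import Relation.Binary.PropositionalEquality using (_≡_; _≢_; refl; sym; trans; cong; subst; module ≡-Reasoning)
open import Function.Definitions using (Injective)
open import Function.Bundles using (Equivalence)

private
  variable
    n m k : ℕ

≤-foldr-⊔ : ∀ {A : Set} (f : A → ℕ) {xs : List A} {x : A} →
            x ∈ₗ xs → f x ≤ List.foldr _⊔_ 0 (List.map f xs)
≤-foldr-⊔ f {y List.∷ _} (here refl) = m≤m⊔n (f y) _
≤-foldr-⊔ f {y List.∷ _} (there x∈xs) = ≤-trans (≤-foldr-⊔ f x∈xs) (m≤n⊔m (f y) _)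

degree≤maxDeg : (G : Graph n) (x : Fin n) → degree G x ≤ maxDeg G
degree≤maxDeg G x = ≤-foldr-⊔ (degree G) (∈-allFin x)

injective-into-neighbours⇒≤degree : (G : Graph n) (x : Fin n) (h : Fin k → Fin n) →
  Injective _≡_ _≡_ h → (∀ i → Adj G x (h i)) → k ≤ degree G x
injective-into-neighbours⇒≤degree {n} {k} G x h h-injective x~h =
  injective⇒≤ {f = position} position-injective
  where
  neighbours : List (Fin n)
  neighbours = List.filter (λ u → Data.Bool._≟_ (adj G x u) true) (List.allFin n)

  h∈neighbours : ∀ i → h i ∈ₗ neighbours
  h∈neighbours i = ∈-filter⁺ _ (∈-allFin (h i)) (Equivalence.to T-≡ (x~h i))

  position : Fin k → Fin (length neighbours)
  position i = index (h∈neighbours i)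

  position-injective : Injective _≡_ _≡_ position
  position-injective {i} {j} eq = h-injective (begin
    h i                                     ≡⟨ lookup-index (h∈neighbours i) ⟩
    List.lookup neighbours (position i)     ≡⟨ cong (List.lookup neighbours) eq ⟩
    List.lookup neighbours (position j)     ≡⟨ sym (lookup-index (h∈neighbours j)) ⟩
    h j                                     ∎)
    where open ≡-Reasoning

suc-degree≤maxDeg+1 : (G : Graph n) (x : Fin n) → suc (degree G x) ≤ maxDeg G + 1
suc-degree≤maxDeg+1 G x =
  subst (_≤ maxDeg G + 1) (+-comm (degree G x) 1) (+-monoˡ-≤ 1 (degree≤maxDeg G x))

covered-by-two⇒≤2 : (a b : Fin m) → (∀ i → i ≡ a ⊎ i ≡ b) → m ≤ 2
covered-by-two⇒≤2 {suc m} a b cover =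
  s≤s (injective⇒≤ {f = λ (_ : Fin m) → fzero {0}}
        (λ {i} {j} _ → punchIn-injective a i j (trans (punchIn≡b i) (sym (punchIn≡b j)))))
  where
  punchIn≡b : ∀ j → punchIn a j ≡ b
  punchIn≡b j with cover (punchIn a j)
  ... | inj₁ ≡a = ⊥-elim (punchInᵢ≢i a j ≡a)
  ... | inj₂ ≡b = ≡b

NeighbourIn : Graph n → Subset n → Fin n → Set
NeighbourIn G S x = ∃[ u ] (u ∈ S × Adj G x u)

neighbourIn? : (G : Graph n) (S : Subset n) (x : Fin n) → Dec (NeighbourIn G S x)
neighbourIn? G S x = any? (λ u → (u ∈? S) ×-dec T? (adj G x u))

Adj⇒≢ : (G : Graph n) {x u : Fin n} → Adj G x u → u ≢ x
Adj⇒≢ G {x} x~x refl = subst T (irrefl G x) x~x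

neighbours-in-distinct-blocks⇒≤ : (G : Graph n) (B : Fin m → Subset n) →
  (∀ {x i j} → x ∈ B i → x ∈ B j → i ≡ j) → (x : Fin n) (a : Fin m) →
  (∀ i → i ≢ a → NeighbourIn G (B i) x) → m ≤ suc (degree G x)
neighbours-in-distinct-blocks⇒≤ {n} {suc m} G B disjoint x a neighbour =
  s≤s (injective-into-neighbours⇒≤degree G x h h-injective (proj₂ ∘ proj₂ ∘ neighbour′))
  where
  neighbour′ : (j : Fin m) → NeighbourIn G (B (punchIn a j)) x
  neighbour′ j = neighbour (punchIn a j) (punchInᵢ≢i a j)

  h : Fin m → Fin n
  h = proj₁ ∘ neighbour′

  h-injective : Injective _≡_ _≡_ h
  h-injective {i} {j} hi≡hj = punchIn-injective a i j
    (disjoint (proj₁ (proj₂ (neighbour′ i))) (subst (_∈ B _) (sym hi≡hj) (proj₁ (proj₂ (neighbour′ j)))))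

leaf-neighbour-unique : (G : Graph n) {v u w : Fin n} → degree G v ≡ 1 →
  Adj G v u → Adj G v w → u ≡ w
leaf-neighbour-unique {n} G {v} {u} {w} v-leaf v~u v~w with u ≟ᶠ w
... | yes u≡w = u≡w
... | no  u≢w = ⊥-elim (2≰1 (subst (2 ≤_) v-leaf
                  (injective-into-neighbours⇒≤degree G v h h-injective v~h)))
  where
  h : Fin 2 → Fin n
  h fzero = u
  h (fsuc _) = w

  h-injective : Injective _≡_ _≡_ h
  h-injective {fzero}      {fzero}      _   = refl
  h-injective {fzero}      {fsuc fzero} u≡w = ⊥-elim (u≢w u≡w)
  h-injective {fsuc fzero} {fzero}      w≡u = ⊥-elim (u≢w (sym w≡u))
  h-injective {fsuc fzero} {fsuc fzero} _   = refl

  v~h : ∀ i → Adj G v (h i)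
  v~h fzero = v~u
  v~h (fsuc _) = v~w

  2≰1 : ¬ 2 ≤ 1
  2≰1 (s≤s ())

leaf∈TRD : (G : Graph n) {S : Subset n} {v : Fin n} → degree G v ≡ 1 → IsTRD G S → v ∈ S
leaf∈TRD G {S} {v} v-leaf (dominated , _) with v ∈? S
... | yes v∈S = v∈S
... | no  v∉S =
  let (u , u∈S , v~u) , (w , w∉S , _ , v~w) = dominated v v∉S
  in  ⊥-elim (w∉S (subst (_∈ S) (leaf-neighbour-unique G v-leaf v~u v~w) u∈S))

support∈TRD : (G : Graph n) {S : Subset n} {v u : Fin n} → degree G v ≡ 1 → Adj G v u →
  IsTRD G S → u ∈ S
support∈TRD G {S} v-leaf v~u trd@(_ , totally-dominated) =
  let w , w∈S , _ , v~w = totally-dominated _ (leaf∈TRD G v-leaf trd)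
  in  subst (_∈ S) (leaf-neighbour-unique G v-leaf v~w v~u) w∈S

∉∪ : {S T : Subset n} {x : Fin n} → x ∉ S → x ∉ T → x ∉ S ∪ T
∉∪ {S = S} {T} x∉S x∉T x∈S∪T with x∈p∪q⁻ S T x∈S∪T
... | inj₁ x∈S = x∉S x∈S
... | inj₂ x∈T = x∉T x∈T

TRD⇒neighbourIn : (G : Graph n) {S : Subset n} → IsTRD G S → ∀ x → NeighbourIn G S x
TRD⇒neighbourIn G {S} (dominated , totally-dominated) x with x ∈? S
... | yes x∈S = let u , u∈S , _ , x~u = totally-dominated x x∈S in u , u∈S , x~u
... | no  x∉S = proj₁ (dominated x x∉S)

TRD-∪⇒neighbourIn : (G : Graph n) {S T : Subset n} {x : Fin n} → IsTRD G (S ∪ T) →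
  ¬ NeighbourIn G S x → NeighbourIn G T x
TRD-∪⇒neighbourIn G {S} {T} {x} trd x↛S with TRD⇒neighbourIn G trd x
... | u , u∈S∪T , x~u with x∈p∪q⁻ S T u∈S∪T
...   | inj₁ u∈S = ⊥-elim (x↛S (u , u∈S , x~u))
...   | inj₂ u∈T = u , u∈T , x~u

TRD-∪⇒neighbourOutside : (G : Graph n) {S T : Subset n} {x : Fin n} → IsTRD G (S ∪ T) →
  x ∉ S → x ∉ T → NeighbourIn G (∁ S) x
TRD-∪⇒neighbourOutside G {S} {T} (dominated , _) x∉S x∉T =
  let w , w∉S∪T , _ , x~w = proj₂ (dominated _ (∉∪ x∉S x∉T))
  in  w , x∉p⇒x∈∁p (w∉S∪T ∘ p⊆p∪q T) , x~w

-- Since a neighbour is never the vertex itself, IsTRD only asks every vertex to have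
-- a neighbour in S, and every vertex outside S to have a neighbour outside S.
¬TRD⇒obstruction : (G : Graph n) (S : Subset n) → ¬ IsTRD G S →
  (∃[ x ] ¬ NeighbourIn G S x) ⊎ (∃[ x ] (x ∉ S × ¬ NeighbourIn G (∁ S) x))
¬TRD⇒obstruction G S ¬trd
  with any? (λ x → ¬? (neighbourIn? G S x))
     | any? (λ x → ¬? (x ∈? S) ×-dec ¬? (neighbourIn? G (∁ S) x))
... | yes undominated  | _            = inj₁ undominated
... | no  _            | yes enclosed = inj₂ enclosed
... | no  ¬undominated | no ¬enclosed = ⊥-elim (¬trd (dominated , totally-dominated))
  where
  inside : ∀ x → NeighbourIn G S x
  inside x = decidable-stable (neighbourIn? G S x) (λ x↛S → ¬undominated (x , x↛S))

  outside : ∀ x → x ∉ S → NeighbourIn G (∁ S) x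
  outside x x∉S = decidable-stable (neighbourIn? G (∁ S) x) (λ x↛∁S → ¬enclosed (x , x∉S , x↛∁S))

  dominated : ∀ x → x ∉ S → NeighbourIn G S x × ∃[ w ] (w ∉ S × w ≢ x × Adj G x w)
  dominated x x∉S =
    let w , w∈∁S , x~w = outside x x∉S
    in  inside x , (w , x∈∁p⇒x∉p w∈∁S , Adj⇒≢ G x~w , x~w)

  totally-dominated : ∀ x → x ∈ S → ∃[ u ] (u ∈ S × u ≢ x × Adj G x u)
  totally-dominated x _ = let u , u∈S , x~u = inside x in u , u∈S , Adj⇒≢ G x~u , x~u

module TrcPartition {n} (G : Graph n) {Φ : List (Subset n)} (trc : IsTrcPartition G Φ) where

  block : Fin (length Φ) → Subset n
  block = List.lookup Φ

  blockOf : Fin n → Fin (length Φ)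
  blockOf x = proj₁ (proj₂ (proj₁ trc) x)

  block-unique : ∀ {x i} → x ∈ block i → i ≡ blockOf x
  block-unique {x} {i} = proj₂ (proj₂ (proj₂ (proj₁ trc) x)) i

  blocks-disjoint : ∀ {x i j} → x ∈ block i → x ∈ block j → i ≡ j
  blocks-disjoint x∈i x∈j = trans (block-unique x∈i) (sym (block-unique x∈j))

  partner : Fin (length Φ) → Fin (length Φ)
  partner i = proj₁ (proj₂ (proj₂ trc) i)

  partner-coalition : ∀ i → IsTRD G (block i ∪ block (partner i))
  partner-coalition i = proj₂ (proj₂ (proj₂ (proj₂ (proj₂ (proj₂ (proj₂ trc) i)))))

  ∈coalition⇒blockOf : ∀ {x} i → x ∈ block i ∪ block (partner i) →
    i ≡ blockOf x ⊎ partner i ≡ blockOf x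
  ∈coalition⇒blockOf i x∈ with x∈p∪q⁻ (block i) (block (partner i)) x∈
  ... | inj₁ x∈i = inj₁ (block-unique x∈i)
  ... | inj₂ x∈partner = inj₂ (block-unique x∈partner)

  apart-in-every-TRD⇒≤2 : ∀ {v u} → (∀ {S} → IsTRD G S → v ∈ S × u ∈ S) →
    blockOf v ≢ blockOf u → length Φ ≤ 2
  apart-in-every-TRD⇒≤2 {v} {u} v,u∈TRD v≁u = covered-by-two⇒≤2 (blockOf v) (blockOf u) cover
    where
    cover : ∀ i → i ≡ blockOf v ⊎ i ≡ blockOf u
    cover i with v,u∈TRD (partner-coalition i)
    ... | v∈ , u∈ with ∈coalition⇒blockOf i v∈ | ∈coalition⇒blockOf i u∈
    ...   | inj₁ i≡a | _        = inj₁ i≡a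
    ...   | inj₂ _   | inj₁ i≡b = inj₂ i≡b
    ...   | inj₂ p≡a | inj₂ p≡b = ⊥-elim (v≁u (trans (sym p≡a) p≡b))

  in-every-TRD⇒coalition : ∀ {v} → (∀ {S} → IsTRD G S → v ∈ S) →
    ∀ i → i ≢ blockOf v → IsTRD G (block (blockOf v) ∪ block i)
  in-every-TRD⇒coalition v∈TRD i i≢a with ∈coalition⇒blockOf i (v∈TRD (partner-coalition i))
  ... | inj₁ i≡a = ⊥-elim (i≢a i≡a)
  ... | inj₂ p≡a = subst (λ j → IsTRD G (block j ∪ block i)) p≡a
                        (subst (IsTRD G) (∪-comm (block i) (block (partner i))) (partner-coalition i))

  module _ (a : Fin (length Φ)) (coalition : ∀ i → i ≢ a → IsTRD G (block a ∪ block i)) where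

    undominated⇒≤ : ∀ {x} → ¬ NeighbourIn G (block a) x → length Φ ≤ suc (degree G x)
    undominated⇒≤ {x} x↛a = neighbours-in-distinct-blocks⇒≤ G block blocks-disjoint x a
      (λ i i≢a → TRD-∪⇒neighbourIn G (coalition i i≢a) x↛a)

    enclosed⇒≤2 : ∀ {x} → x ∉ block a → ¬ NeighbourIn G (∁ (block a)) x → length Φ ≤ 2
    enclosed⇒≤2 {x} x∉a x↛outside = covered-by-two⇒≤2 a (blockOf x) cover
      where
      cover : ∀ i → i ≡ a ⊎ i ≡ blockOf x
      cover i with i ≟ᶠ a | i ≟ᶠ blockOf x
      ... | yes i≡a | _ = inj₁ i≡a
      ... | no  _   | yes i≡x = inj₂ i≡x
      ... | no  i≢a | no  i≢x = ⊥-elim (x↛outside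
              (TRD-∪⇒neighbourOutside G (coalition i i≢a) x∉a (i≢x ∘ block-unique)))

theorem2p12 : ∀ {n : ℕ} (G : Graph n) → NoIsolated G → MinDegOne G →
    (Φ : List (Subset n)) → IsTrcPartition G Φ → length Φ ≤ maxDeg G + 1
theorem2p12 {n} G noIsolated (_ , v , v-leaf) Φ trc@(_ , no-block-TRD , _) =
  by-blocks (blockOf v ≟ᶠ blockOf u)
  where
  open TrcPartition G trc

  u : Fin n
  u = proj₁ (noIsolated v)

  a : Fin (length Φ)
  a = blockOf v

  v∈TRD : ∀ {S} → IsTRD G S → v ∈ S
  v∈TRD = leaf∈TRD G v-leaf

  2≤Δ+1 : 2 ≤ maxDeg G + 1
  2≤Δ+1 = subst (_≤ maxDeg G + 1) (cong suc v-leaf) (suc-degree≤maxDeg+1 G v)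

  by-obstruction : (∃[ x ] ¬ NeighbourIn G (block a) x) ⊎ (∃[ x ] (x ∉ block a × ¬ NeighbourIn G (∁ (block a)) x)) →
    length Φ ≤ maxDeg G + 1
  by-obstruction (inj₁ (x , x↛a)) =
    ≤-trans (undominated⇒≤ a (in-every-TRD⇒coalition v∈TRD) x↛a) (suc-degree≤maxDeg+1 G x)
  by-obstruction (inj₂ (x , x∉a , x↛outside)) =
    ≤-trans (enclosed⇒≤2 a (in-every-TRD⇒coalition v∈TRD) x∉a x↛outside) 2≤Δ+1

  by-blocks : Dec (blockOf v ≡ blockOf u) → length Φ ≤ maxDeg G + 1
  by-blocks (no v≁u) = ≤-trans (apart-in-every-TRD⇒≤2 v,u∈TRD v≁u) 2≤Δ+1
    where
    v,u∈TRD : ∀ {S} → IsTRD G S → v ∈ S × u ∈ S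
    v,u∈TRD trd = v∈TRD trd , support∈TRD G v-leaf (proj₂ (noIsolated v)) trd
  by-blocks (yes _) = by-obstruction (¬TRD⇒obstruction G (block a) (no-block-TRD a))
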